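{- Let $n\ge1$ and $\mathbf A\in\mathcal V_n$. With $X_k=\mathcal V_n(\mathbf A,\mathbf M_k)$ for $k\in[0,n]$ and $Y=\bigcup_{k\in[0,n]}X_k\times\Omega_k$, the relation $\le_P$ on $Y$ defined by $(x,\omega_1)\le_P(y,\omega_2)$ iff there exists $R\in\mathcal R_{\omega_1\omega_2}$ with $(x(a),y(a))\in R$ for all $a\in A$, is a partial order on $Y$.
   Context: Fix $n\ge1$, $[m,p]=\{k\in\mathbb Z:m\le k\le p\}$. $\mathbf J_n$ has universe $\{\top,\boldsymbol f_0,\dots,\boldsymbol f_n,\boldsymbol t_0,\dots,\boldsymbol t_n,\bot\}$; knowledge order $\le_k$: chains $\bot<\boldsymbol f_n<\dots<\boldsymbol f_0<\top$ and $\bot<\boldsymbol t_n<\dots<\boldsymbol t_0<\top$; truth order $\le_t$: $\boldsymbol f_0<\dots<\boldsymbol f_n<\top,\bot<\boldsymbol t_n<\dots<\boldsymbol t_0$ with $\top,\bot$ incomparable; $\otimes,\oplus$ meet/join for $\le_k$, $\wedge,\vee$ meet/join for $\le_t$; $\neg$ swaps $\boldsymbol f_m\leftrightarrow\boldsymbol t_m$ and fixes $\top,\bot$; all elements are constants. $\mathcal V_n$ is the variety generated by $\mathbf J_n$; $\mathcal V_n(\mathbf A,\mathbf M_k)$ is the set of homomorphisms $\mathbf A\to\mathbf M_k$. $\mathbf M_0$: universe $\{\top^0,\boldsymbol f^0,\boldsymbol t^0,\bot^0\}$, knowledge order $\bot^0<\boldsymbol f^0,\boldsymbol t^0<\top^0$,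 truth order $\boldsymbol f^0<\top^0,\bot^0<\boldsymbol t^0$, $\neg$ swapping $\boldsymbol f^0,\boldsymbol t^0$ and fixing $\top^0,\bot^0$, constants $\top\mapsto\top^0$, $\bot\mapsto\bot^0$, $\boldsymbol f_i\mapsto\boldsymbol f^0$, $\boldsymbol t_i\mapsto\boldsymbol t^0$. For $k\in[1,n]$, $\mathbf M_k$: universe $\{\top^k,\bot^k,\boldsymbol f^k,\boldsymbol t^k,\boldsymbol 0^k,\boldsymbol 1^k\}$, knowledge order with chains $\bot^k<\boldsymbol f^k<\boldsymbol 0^k<\top^k$, $\bot^k<\boldsymbol t^k<\boldsymbol 1^k<\top^k$, truth order $\boldsymbol 0^k<\boldsymbol f^k<\top^k,\bot^k<\boldsymbol t^k<\boldsymbol 1^k$, $\neg$ swapping $\boldsymbol f^k\leftrightarrow\boldsymbol t^k$, $\boldsymbol 0^k\leftrightarrow\boldsymbol 1^k$, fixing $\top^k,\bot^k$; constants $\top\mapsto\top^k$, $\bot\mapsto\bot^k$, $\boldsymbol f_i\mapsto\boldsymbol 0^k$ and $\boldsymbol t_i\mapsto\boldsymbol 1^k$ for $i<k$, $\boldsymbol f_i\mapsto\boldsymbol f^k$ and $\boldsymbol t_i\mapsto\boldsymbol t^k$ for $i\ge k$. Operations $\otimes,\oplus$ and $\wedge,\vee$ on each $\mathbf M_k$ are meet/join for its knowledge and truth orders respectively. Carriers: $\gamma_0,\delta_0\colon M_0\to\{0,1\}$ with $\delta_0^{ -1}(1)=\{\bot^0,\boldsymbol t^0\}$, $\gamma_0^{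 -1}(1)=\{\top^0,\boldsymbol t^0\}$; for $k\in[1,n]$, $\gamma_k,\delta_k\colon M_k\to\{0,1\}$ with $\gamma_k^{ -1}(1)=\{\boldsymbol 1^k\}$, $\delta_k^{ -1}(1)=M_k\setminus\{\boldsymbol 0^k\}$; $\Omega_k=\{\gamma_k,\delta_k\}$. For $\omega_1\in\Omega_j$, $\omega_2\in\Omega_k$, $(\omega_1,\omega_2)^{ -1}(\le)=\{(a,b)\in M_j\times M_k:\omega_1(a)\le\omega_2(b)\}$, and $\mathcal R_{\omega_1\omega_2}$ is the (possibly empty) set of subuniverses of $\mathbf M_j\times\mathbf M_k$ maximal among subuniverses contained in $(\omega_1,\omega_2)^{ -1}(\le)$. -}

module Defs where

open import Data.Bool using (Bool; true; false; if_then_else_) renaming (_≤_ to _≤𝔹_)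
open import Data.Nat using (ℕ; zero; suc; _≤ᵇ_; _<ᵇ_)
open import Data.Fin using (Fin; zero; suc; toℕ; fromℕ)
open import Data.Product using (Σ; _×_; _,_)
open import Relation.Binary.PropositionalEquality using (_≡_; subst)

data Const (n : ℕ) : Set where
  ⊤c ⊥c : Const n
  fc tc : Fin (suc n) → Const n

record Algebra (n : ℕ) : Set₁ where
  field
    Carrier : Set
    _⊗_ _⊕_ _∧_ _∨_ : Carrier → Carrier → Carrier
    ¬_ : Carrier → Carrier
    const : Const n → Carrier
open Algebra public

data Term (n : ℕ) : Set where
  var : ℕ → Term n
  con : Const n → Term n
  _⊗'_ _⊕'_ _∧'_ _∨'_ : Term n → Term n → Term n
  ¬'_ : Term n → Term n

eval : ∀ {n} (A : Algebra n) → (ℕ → Carrier A) → Term n → Carrier A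
eval A ρ (var x) = ρ x
eval A ρ (con c) = const A c
eval A ρ (s ⊗' t) = _⊗_ A (eval A ρ s) (eval A ρ t)
eval A ρ (s ⊕' t) = _⊕_ A (eval A ρ s) (eval A ρ t)
eval A ρ (s ∧' t) = _∧_ A (eval A ρ s) (eval A ρ t)
eval A ρ (s ∨' t) = _∨_ A (eval A ρ s) (eval A ρ t)
eval A ρ (¬' t) = ¬_ A (eval A ρ t)

_⊨_≈_ : ∀ {n} (A : Algebra n) → Term n → Term n → Set
A ⊨ s ≈ t = ∀ (ρ : ℕ → Carrier A) → eval A ρ s ≡ eval A ρ t

data J (n : ℕ) : Set where
  ⊤J ⊥J : J n
  fJ tJ : Fin (suc n) → J n

maxF minF : ∀ {n} → Fin n → Fin n → Fin n
maxF i j = if toℕ i ≤ᵇ toℕ j then j else i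
minF i j = if toℕ i ≤ᵇ toℕ j then i else j

-- knowledge order: ⊥ < fₙ < … < f₀ < ⊤,  ⊥ < tₙ < … < t₀ < ⊤
data _≤kJ_ {n : ℕ} : J n → J n → Set where
  ⊥≤ : ∀ {x} → ⊥J ≤kJ x
  ≤⊤ : ∀ {x} → x ≤kJ ⊤J
  ff : ∀ {i j} → toℕ j Data.Nat.≤ toℕ i → fJ i ≤kJ fJ j
  tt : ∀ {i j} → toℕ j Data.Nat.≤ toℕ i → tJ i ≤kJ tJ j

-- truth order: f₀ < … < fₙ < ⊤,⊥ < tₙ < … < t₀   (⊤,⊥ incomparable)
data _≤tJ_ {n : ℕ} : J n → J n → Set where
  f≤ : ∀ {i x} → (∀ {j} → x ≡ fJ j → toℕ i Data.Nat.≤ toℕ j) → fJ i ≤tJ x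
  ≤t : ∀ {i x} → (∀ {j} → x ≡ tJ j → toℕ i Data.Nat.≤ toℕ j) → x ≤tJ tJ i
  ⊤⊤ : ⊤J ≤tJ ⊤J
  ⊥⊥ : ⊥J ≤tJ ⊥J

-- ⊗ : meet for ≤k
_⊗J_ : ∀ {n} → J n → J n → J n
⊤J ⊗J y = y
⊥J ⊗J y = ⊥J
fJ i ⊗J ⊤J = fJ i
fJ i ⊗J ⊥J = ⊥J
fJ i ⊗J fJ j = fJ (maxF i j)
fJ i ⊗J tJ j = ⊥J
tJ i ⊗J ⊤J = tJ i
tJ i ⊗J ⊥J = ⊥J
tJ i ⊗J fJ j = ⊥J
tJ i ⊗J tJ j = tJ (maxF i j)

-- ⊕ : join for ≤k
_⊕J_ : ∀ {n} → J n → J n → J n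
⊤J ⊕J y = ⊤J
⊥J ⊕J y = y
fJ i ⊕J ⊤J = ⊤J
fJ i ⊕J ⊥J = fJ i
fJ i ⊕J fJ j = fJ (minF i j)
fJ i ⊕J tJ j = ⊤J
tJ i ⊕J ⊤J = ⊤J
tJ i ⊕J ⊥J = tJ i
tJ i ⊕J fJ j = ⊤J
tJ i ⊕J tJ j = tJ (minF i j)

-- ∧ : meet for ≤t
_∧J_ : ∀ {n} → J n → J n → J n
fJ i ∧J fJ j = fJ (minF i j)
fJ i ∧J y = fJ i
⊤J ∧J fJ j = fJ j
⊤J ∧J ⊤J = ⊤J
⊤J ∧J ⊥J = fJ (fromℕ _)
⊤J ∧J tJ j = ⊤J
⊥J ∧J fJ j = fJ j
⊥J ∧J ⊤J = fJ (fromℕ _)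
⊥J ∧J ⊥J = ⊥J
⊥J ∧J tJ j = ⊥J
tJ i ∧J tJ j = tJ (maxF i j)
tJ i ∧J y = y

-- ∨ : join for ≤t
_∨J_ : ∀ {n} → J n → J n → J n
tJ i ∨J tJ j = tJ (minF i j)
tJ i ∨J y = tJ i
⊤J ∨J tJ j = tJ j
⊤J ∨J ⊤J = ⊤J
⊤J ∨J ⊥J = tJ (fromℕ _)
⊤J ∨J fJ j = ⊤J
⊥J ∨J tJ j = tJ j
⊥J ∨J ⊤J = tJ (fromℕ _)
⊥J ∨J ⊥J = ⊥J
⊥J ∨J fJ j = ⊥J
fJ i ∨J fJ j = fJ (maxF i j)
fJ i ∨J y = y

¬J : ∀ {n} → J n → J n
¬J ⊤J = ⊤J
¬J ⊥J = ⊥J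
¬J (fJ i) = tJ i
¬J (tJ i) = fJ i

constJ : ∀ {n} → Const n → J n
constJ ⊤c = ⊤J
constJ ⊥c = ⊥J
constJ (fc i) = fJ i
constJ (tc i) = tJ i

𝐉 : (n : ℕ) → Algebra n
𝐉 n = record
  { Carrier = J n ; _⊗_ = _⊗J_ ; _⊕_ = _⊕J_ ; _∧_ = _∧J_ ; _∨_ = _∨J_
  ; ¬_ = ¬J ; const = constJ }

-- membership in the variety 𝒱ₙ generated by 𝐉ₙ (= Mod(Id(𝐉ₙ)), Birkhoff)
_∈𝒱 : ∀ {n} → Algebra n → Set
_∈𝒱 {n} A = ∀ (s t : Term n) → 𝐉 n ⊨ s ≈ t → A ⊨ s ≈ t

record IsHom {n} (A B : Algebra n) (h : Carrier A → Carrier B) : Set where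
  field
    pres-⊗ : ∀ a b → h (_⊗_ A a b) ≡ _⊗_ B (h a) (h b)
    pres-⊕ : ∀ a b → h (_⊕_ A a b) ≡ _⊕_ B (h a) (h b)
    pres-∧ : ∀ a b → h (_∧_ A a b) ≡ _∧_ B (h a) (h b)
    pres-∨ : ∀ a b → h (_∨_ A a b) ≡ _∨_ B (h a) (h b)
    pres-¬ : ∀ a → h (¬_ A a) ≡ ¬_ B (h a)
    pres-c : ∀ c → h (const A c) ≡ const B c

Hom : ∀ {n} → Algebra n → Algebra n → Set
Hom A B = Σ (Carrier A → Carrier B) (IsHom A B)

data M₀ : Set where
  ⊤⁰ f⁰ t⁰ ⊥⁰ : M₀

-- 𝐌₀ operations (knowledge: ⊥ < f,t < ⊤ ; truth: f < ⊤,⊥ < t)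
_⊗₀_ _⊕₀_ _∧₀_ _∨₀_ : M₀ → M₀ → M₀
⊤⁰ ⊗₀ y = y
⊥⁰ ⊗₀ y = ⊥⁰
f⁰ ⊗₀ ⊤⁰ = f⁰
f⁰ ⊗₀ f⁰ = f⁰
f⁰ ⊗₀ _ = ⊥⁰
t⁰ ⊗₀ ⊤⁰ = t⁰
t⁰ ⊗₀ t⁰ = t⁰
t⁰ ⊗₀ _ = ⊥⁰

⊤⁰ ⊕₀ y = ⊤⁰
⊥⁰ ⊕₀ y = y
f⁰ ⊕₀ ⊥⁰ = f⁰
f⁰ ⊕₀ f⁰ = f⁰
f⁰ ⊕₀ _ = ⊤⁰
t⁰ ⊕₀ ⊥⁰ = t⁰
t⁰ ⊕₀ t⁰ = t⁰
t⁰ ⊕₀ _ = ⊤⁰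

f⁰ ∧₀ y = f⁰
t⁰ ∧₀ y = y
⊤⁰ ∧₀ ⊤⁰ = ⊤⁰
⊤⁰ ∧₀ t⁰ = ⊤⁰
⊤⁰ ∧₀ _ = f⁰
⊥⁰ ∧₀ ⊥⁰ = ⊥⁰
⊥⁰ ∧₀ t⁰ = ⊥⁰
⊥⁰ ∧₀ _ = f⁰

t⁰ ∨₀ y = t⁰
f⁰ ∨₀ y = y
⊤⁰ ∨₀ ⊤⁰ = ⊤⁰
⊤⁰ ∨₀ f⁰ = ⊤⁰
⊤⁰ ∨₀ _ = t⁰
⊥⁰ ∨₀ ⊥⁰ = ⊥⁰
⊥⁰ ∨₀ f⁰ = ⊥⁰
⊥⁰ ∨₀ _ = t⁰

¬₀ : M₀ → M₀
¬₀ ⊤⁰ = ⊤⁰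
¬₀ ⊥⁰ = ⊥⁰
¬₀ f⁰ = t⁰
¬₀ t⁰ = f⁰

data M₊ : Set where
  ⊤⁺ ⊥⁺ f⁺ t⁺ 0⁺ 1⁺ : M₊

data _≤k₊_ : M₊ → M₊ → Set where
  ⊥≤ : ∀ {x} → ⊥⁺ ≤k₊ x
  ≤⊤ : ∀ {x} → x ≤k₊ ⊤⁺
  f≤f : f⁺ ≤k₊ f⁺
  f≤0 : f⁺ ≤k₊ 0⁺
  0≤0 : 0⁺ ≤k₊ 0⁺
  t≤t : t⁺ ≤k₊ t⁺
  t≤1 : t⁺ ≤k₊ 1⁺
  1≤1 : 1⁺ ≤k₊ 1⁺

data _≤t₊_ : M₊ → M₊ → Set where
  0≤ : ∀ {x} → 0⁺ ≤t₊ x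
  ≤1 : ∀ {x} → x ≤t₊ 1⁺
  f≤f : f⁺ ≤t₊ f⁺
  f≤⊤ : f⁺ ≤t₊ ⊤⁺
  f≤⊥ : f⁺ ≤t₊ ⊥⁺
  f≤t : f⁺ ≤t₊ t⁺
  ⊤≤⊤ : ⊤⁺ ≤t₊ ⊤⁺
  ⊤≤t : ⊤⁺ ≤t₊ t⁺
  ⊥≤⊥ : ⊥⁺ ≤t₊ ⊥⁺
  ⊥≤t : ⊥⁺ ≤t₊ t⁺
  t≤t : t⁺ ≤t₊ t⁺

_⊗₊_ _⊕₊_ _∧₊_ _∨₊_ : M₊ → M₊ → M₊
⊤⁺ ⊗₊ y = y
⊥⁺ ⊗₊ y = ⊥⁺
f⁺ ⊗₊ ⊤⁺ = f⁺
f⁺ ⊗₊ f⁺ = f⁺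
f⁺ ⊗₊ 0⁺ = f⁺
f⁺ ⊗₊ _ = ⊥⁺
0⁺ ⊗₊ ⊤⁺ = 0⁺
0⁺ ⊗₊ 0⁺ = 0⁺
0⁺ ⊗₊ f⁺ = f⁺
0⁺ ⊗₊ _ = ⊥⁺
t⁺ ⊗₊ ⊤⁺ = t⁺
t⁺ ⊗₊ t⁺ = t⁺
t⁺ ⊗₊ 1⁺ = t⁺
t⁺ ⊗₊ _ = ⊥⁺
1⁺ ⊗₊ ⊤⁺ = 1⁺
1⁺ ⊗₊ 1⁺ = 1⁺
1⁺ ⊗₊ t⁺ = t⁺
1⁺ ⊗₊ _ = ⊥⁺

⊤⁺ ⊕₊ y = ⊤⁺
⊥⁺ ⊕₊ y = y
f⁺ ⊕₊ ⊥⁺ = f⁺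
f⁺ ⊕₊ f⁺ = f⁺
f⁺ ⊕₊ 0⁺ = 0⁺
f⁺ ⊕₊ _ = ⊤⁺
0⁺ ⊕₊ ⊥⁺ = 0⁺
0⁺ ⊕₊ f⁺ = 0⁺
0⁺ ⊕₊ 0⁺ = 0⁺
0⁺ ⊕₊ _ = ⊤⁺
t⁺ ⊕₊ ⊥⁺ = t⁺
t⁺ ⊕₊ t⁺ = t⁺
t⁺ ⊕₊ 1⁺ = 1⁺
t⁺ ⊕₊ _ = ⊤⁺
1⁺ ⊕₊ ⊥⁺ = 1⁺
1⁺ ⊕₊ t⁺ = 1⁺
1⁺ ⊕₊ 1⁺ = 1⁺
1⁺ ⊕₊ _ = ⊤⁺

0⁺ ∧₊ y = 0⁺
1⁺ ∧₊ y = y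
f⁺ ∧₊ 0⁺ = 0⁺
f⁺ ∧₊ y = f⁺
t⁺ ∧₊ 1⁺ = t⁺
t⁺ ∧₊ y = y
⊤⁺ ∧₊ ⊤⁺ = ⊤⁺
⊤⁺ ∧₊ t⁺ = ⊤⁺
⊤⁺ ∧₊ 1⁺ = ⊤⁺
⊤⁺ ∧₊ 0⁺ = 0⁺
⊤⁺ ∧₊ _ = f⁺
⊥⁺ ∧₊ ⊥⁺ = ⊥⁺
⊥⁺ ∧₊ t⁺ = ⊥⁺
⊥⁺ ∧₊ 1⁺ = ⊥⁺
⊥⁺ ∧₊ 0⁺ = 0⁺
⊥⁺ ∧₊ _ = f⁺

1⁺ ∨₊ y = 1⁺
0⁺ ∨₊ y = y
t⁺ ∨₊ 1⁺ = 1⁺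
t⁺ ∨₊ y = t⁺
f⁺ ∨₊ 0⁺ = f⁺
f⁺ ∨₊ y = y
⊤⁺ ∨₊ ⊤⁺ = ⊤⁺
⊤⁺ ∨₊ f⁺ = ⊤⁺
⊤⁺ ∨₊ 0⁺ = ⊤⁺
⊤⁺ ∨₊ 1⁺ = 1⁺
⊤⁺ ∨₊ _ = t⁺
⊥⁺ ∨₊ ⊥⁺ = ⊥⁺
⊥⁺ ∨₊ f⁺ = ⊥⁺
⊥⁺ ∨₊ 0⁺ = ⊥⁺
⊥⁺ ∨₊ 1⁺ = 1⁺
⊥⁺ ∨₊ _ = t⁺

¬₊ : M₊ → M₊
¬₊ ⊤⁺ = ⊤⁺
¬₊ ⊥⁺ = ⊥⁺
¬₊ f⁺ = t⁺
¬₊ t⁺ = f⁺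
¬₊ 0⁺ = 1⁺
¬₊ 1⁺ = 0⁺


const₀ : ∀ {n} → Const n → M₀
const₀ ⊤c = ⊤⁰
const₀ ⊥c = ⊥⁰
const₀ (fc i) = f⁰
const₀ (tc i) = t⁰

const₊ : ∀ {n} → ℕ → Const n → M₊
const₊ k ⊤c = ⊤⁺
const₊ k ⊥c = ⊥⁺
const₊ k (fc i) = if toℕ i <ᵇ k then 0⁺ else f⁺
const₊ k (tc i) = if toℕ i <ᵇ k then 1⁺ else t⁺

𝐌 : ∀ {n} → Fin (suc n) → Algebra n
𝐌 zero = record
  { Carrier = M₀ ; _⊗_ = _⊗₀_ ; _⊕_ = _⊕₀_ ; _∧_ = _∧₀_ ; _∨_ = _∨₀_
  ; ¬_ = ¬₀ ; const = const₀ }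
𝐌 k@(suc _) = record
  { Carrier = M₊ ; _⊗_ = _⊗₊_ ; _⊕_ = _⊕₊_ ; _∧_ = _∧₊_ ; _∨_ = _∨₊_
  ; ¬_ = ¬₊ ; const = const₊ (toℕ k) }

-- index k ∈ [0,n] is  k : Fin (suc n)
MCar : ∀ {n} → Fin (suc n) → Set
MCar k = Carrier (𝐌 k)

data Ω : Set where
  γ δ : Ω

ωval : ∀ {n} (k : Fin (suc n)) → Ω → MCar k → Bool
ωval zero γ ⊤⁰ = true
ωval zero γ t⁰ = true
ωval zero γ _ = false
ωval zero δ ⊥⁰ = true
ωval zero δ t⁰ = true
ωval zero δ _ = false
ωval (suc _) γ 1⁺ = true
ωval (suc _) γ _ = false
ωval (suc _) δ 0⁺ = false
ωval (suc _) δ _ = true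

Rel₂ : ∀ {n} → Fin (suc n) → Fin (suc n) → Set
Rel₂ j k = MCar j → MCar k → Bool

Sub : ∀ {n} (j k : Fin (suc n)) → Rel₂ j k → Rel₂ j k → Set
Sub j k R S = ∀ a b → R a b ≡ true → S a b ≡ true

IsSubuniverse : ∀ {n} (j k : Fin (suc n)) → Rel₂ j k → Set
IsSubuniverse {n} j k R =
    (∀ a b a' b' → R (a) (b) ≡ true → R (a') (b') ≡ true →
        R (_⊗_ (𝐌 j) a a') (_⊗_ (𝐌 k) b b') ≡ true)
  × (∀ a b a' b' → R (a) (b) ≡ true → R (a') (b') ≡ true →
        R (_⊕_ (𝐌 j) a a') (_⊕_ (𝐌 k) b b') ≡ true)
  × (∀ a b a' b' → R (a) (b) ≡ true → R (a') (b') ≡ true →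
        R (_∧_ (𝐌 j) a a') (_∧_ (𝐌 k) b b') ≡ true)
  × (∀ a b a' b' → R (a) (b) ≡ true → R (a') (b') ≡ true →
        R (_∨_ (𝐌 j) a a') (_∨_ (𝐌 k) b b') ≡ true)
  × (∀ a b → R (a) (b) ≡ true → R (¬_ (𝐌 j) a) (¬_ (𝐌 k) b) ≡ true)
  × (∀ (c : Const n) → R (const (𝐌 j) c) (const (𝐌 k) c) ≡ true)

preLe : ∀ {n} (j k : Fin (suc n)) → Ω → Ω → Rel₂ j k
preLe j k ω₁ ω₂ a b = ωle (ωval j ω₁ a) (ωval k ω₂ b)
  where
  ωle : Bool → Bool → Bool
  ωle true false = false
  ωle _ _ = true

In𝓡 : ∀ {n} (j k : Fin (suc n)) → Ω → Ω → Rel₂ j k → Set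
In𝓡 j k ω₁ ω₂ R =
    IsSubuniverse j k R
  × Sub j k R (preLe j k ω₁ ω₂)
  × (∀ (S : Rel₂ j k) → IsSubuniverse j k S → Sub j k S (preLe j k ω₁ ω₂) →
        Sub j k R S → Sub j k S R)

record Y {n} (A : Algebra n) : Set where
  constructor ⟨_,_,_⟩
  field
    idx : Fin (suc n)
    hom : Hom A (𝐌 idx)
    car : Ω

_≤P_ : ∀ {n} {A : Algebra n} → Y A → Y A → Set
_≤P_ {A = A} ⟨ j , (x , _) , ω₁ ⟩ ⟨ k , (y , _) , ω₂ ⟩ =
  Σ (Rel₂ j k) λ R → In𝓡 j k ω₁ ω₂ R × (∀ (a : Carrier A) → R (x a) (y a) ≡ true)

_≈Y_ : ∀ {n} {A : Algebra n} → Y A → Y A → Set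
⟨ j , (x , _) , ω₁ ⟩ ≈Y ⟨ k , (y , _) , ω₂ ⟩ =
  Σ (j ≡ k) λ p → (ω₁ ≡ ω₂) × (∀ a → subst MCar p (x a) ≡ y a)

-- Reflexivity and transitivity of ≤P use nothing specific about the 𝐌ₖ: the diagonal of 𝐌ₖ
-- and the relational composite of two subuniverses lying below (ω₁,ω₂)⁻¹(≤) and (ω₂,ω₃)⁻¹(≤)
-- are subuniverses below (ω,ω)⁻¹(≤) and (ω₁,ω₃)⁻¹(≤), and in the finite product 𝐌ⱼ × 𝐌ₖ every
-- such subuniverse lies in a maximal one, i.e. in a member of 𝓡. (It is found greedily: run
-- through the pairs and absorb each one that fits into some larger admissible subuniverse,
-- which is decidable by exhausting all subsets.)
-- For antisymmetry, x ≤P y ≤P x gives ω₁(x(a)) = ω₂(y(a)) for all a, hence, as homomorphisms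
-- commute with terms, ω₁(t(x(a))) = ω₂(t(y(a))) for every unary term t. For the constants this
-- forces j = k and ω₁ = ω₂; and the six terms x, ¬x, x ⊕ f₀, x ⊕ t₀, ¬x ⊕ f₀, ¬x ⊕ t₀ separate
-- the points of 𝐌ₖ under either carrier, so x = y.

module Submission where

open import Defs
open import Data.Nat using (ℕ; _≥_)
open import Relation.Binary.Structures using (IsPartialOrder)

open import Data.Bool using (Bool; true; false; if_then_else_; not; T)
import Data.Bool as Bool
open import Data.Bool.Properties using (⇔→≡; not-injective)
open import Data.Empty using (⊥-elim)
open import Data.Fin using (Fin; zero; suc; toℕ; combine; remQuot; #_)
import Data.Fin.Properties as Fin
open import Data.Fin.Subset.Properties using (anySubset?)
open import Data.List using (List; []; _∷_; map; allFin)
open import Data.List.Membership.Propositional using (_∈_)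
open import Data.List.Membership.Propositional.Properties using (∈-map⁺; ∈-allFin)
open import Data.List.Properties using (≡-dec; map-cong)
open import Data.List.Relation.Unary.Any using (here; there)
open import Data.Nat using (suc; _*_; _<ᵇ_)
open import Data.Nat.Properties using (<-cmp; <-irrefl; <ᵇ⇒<; <⇒<ᵇ)
open import Data.Product using (Σ; ∃; _×_; _,_; proj₁; proj₂; curry; uncurry)
import Data.Product as Product
open import Data.Vec using (Vec; []; _∷_; lookup; tabulate)
open import Data.Vec.Properties using (lookup∘tabulate)
open import Function using (_∘_; id; mk⇔)
open import Relation.Binary.Definitions using (tri<; tri≈; tri>)
open import Relation.Binary.PropositionalEquality
  using (_≡_; refl; sym; trans; cong; cong₂; subst; subst₂; _≗_)
open import Relation.Binary.Structures using (IsEquivalence)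
open import Relation.Nullary using (Dec; yes; no; does; _×-dec_; _→-dec_)
open import Relation.Nullary.Decidable using (map′; dec-true; toWitness; True)

witness : ∀ {P : Set} (d : Dec P) → does d ≡ true → P
witness (yes p) _ = p

_⊆_ : {A : Set} → (A → Bool) → (A → Bool) → Set
S ⊆ T = ∀ a → S a ≡ true → T a ≡ true

record Finite (A : Set) : Set where
  field
    size : ℕ
    encode : A → Fin size
    decode : Fin size → A
    decode-encode : ∀ a → decode (encode a) ≡ a

  all? : {P : A → Set} → (∀ a → Dec (P a)) → Dec (∀ a → P a)
  all? {P} P? = map′ (λ h a → subst P (decode-encode a) (h (encode a))) (λ h i → h (decode i))
                     (Fin.all? (P? ∘ decode))

  any? : {P : A → Set} → (∀ a → Dec (P a)) → Dec (∃ P)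
  any? {P} P? = map′ (λ (i , p) → decode i , p)
                     (λ (a , p) → encode a , subst P (sym (decode-encode a)) p)
                     (Fin.any? (P? ∘ decode))

  _≟_ : (a b : A) → Dec (a ≡ b)
  a ≟ b = map′ (λ e → trans (sym (decode-encode a)) (trans (cong decode e) (decode-encode b)))
               (cong encode) (encode a Fin.≟ encode b)

  _⊆?_ : ∀ S T → Dec (S ⊆ T)
  S ⊆? T = all? λ a → S a Bool.≟ true →-dec T a Bool.≟ true

  elements : List A
  elements = map decode (allFin size)

  ∈-elements : ∀ a → a ∈ elements
  ∈-elements a = subst (_∈ elements) (decode-encode a) (∈-map⁺ decode (∈-allFin (encode a)))

  any-subset? : {P : (A → Bool) → Set} → (∀ {S S'} → S ≗ S' → P S → P S') →
                (∀ S → Dec (P S)) → Dec (∃ P)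
  any-subset? {P} P-resp P? =
    map′ (λ (v , p) → fromVec v , p) (λ (S , p) → toVec S , P-resp (fromVec∘toVec S) p)
         (anySubset? (P? ∘ fromVec))
    where
    fromVec : Vec Bool size → A → Bool
    fromVec v a = lookup v (encode a)
    toVec : (A → Bool) → Vec Bool size
    toVec S = tabulate (S ∘ decode)
    fromVec∘toVec : ∀ S → S ≗ fromVec (toVec S)
    fromVec∘toVec S a =
      sym (trans (lookup∘tabulate (S ∘ decode) (encode a)) (cong S (decode-encode a)))

×-finite : {A B : Set} → Finite A → Finite B → Finite (A × B)
×-finite FA FB = record
  { size = A.size * B.size
  ; encode = λ (a , b) → combine (A.encode a) (B.encode b)
  ; decode = Product.map A.decode B.decode ∘ remQuot B.size
  ; decode-encode = λ (a , b) →
      trans (cong (Product.map A.decode B.decode) (Fin.remQuot-combine (A.encode a) (B.encode b)))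
            (cong₂ _,_ (A.decode-encode a) (B.decode-encode b))
  }
  where
  module A = Finite FA
  module B = Finite FB

M₀-finite : Finite M₀
M₀-finite = record
  { size = 4
  ; encode = λ { ⊤⁰ → # 0 ; f⁰ → # 1 ; t⁰ → # 2 ; ⊥⁰ → # 3 }
  ; decode = lookup (⊤⁰ ∷ f⁰ ∷ t⁰ ∷ ⊥⁰ ∷ [])
  ; decode-encode = λ { ⊤⁰ → refl ; f⁰ → refl ; t⁰ → refl ; ⊥⁰ → refl }
  }

M₊-finite : Finite M₊
M₊-finite = record
  { size = 6
  ; encode = λ { ⊤⁺ → # 0 ; ⊥⁺ → # 1 ; f⁺ → # 2 ; t⁺ → # 3 ; 0⁺ → # 4 ; 1⁺ → # 5 }
  ; decode = lookup (⊤⁺ ∷ ⊥⁺ ∷ f⁺ ∷ t⁺ ∷ 0⁺ ∷ 1⁺ ∷ [])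
  ; decode-encode = λ { ⊤⁺ → refl ; ⊥⁺ → refl ; f⁺ → refl ; t⁺ → refl ; 0⁺ → refl ; 1⁺ → refl }
  }

MCar-finite : ∀ {n} (k : Fin (suc n)) → Finite (MCar k)
MCar-finite zero = M₀-finite
MCar-finite (suc _) = M₊-finite

module MaximalExtension {A : Set} (finite : Finite A) {P : (A → Bool) → Set}
  (P? : ∀ S → Dec (P S)) (P-resp : ∀ {S S'} → S ≗ S' → P S → P S') where
  open Finite finite

  Extends : (A → Bool) → A → (A → Bool) → Set
  Extends T a S = P S × T ⊆ S × S a ≡ true

  extension? : ∀ T a → Dec (∃ (Extends T a))
  extension? T a = any-subset? resp (λ S → P? S ×-dec T ⊆? S ×-dec S a Bool.≟ true)
    where
    resp : ∀ {S S'} → S ≗ S' → Extends T a S → Extends T a S'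
    resp e (p , T⊆S , Sa) = P-resp e p , (λ b h → trans (sym (e b)) (T⊆S b h)) , trans (sym (e a)) Sa

  extend : (A → Bool) → A → (A → Bool)
  extend T a with extension? T a
  ... | yes (S , _) = S
  ... | no _ = T

  extend-P : ∀ {T a} → P T → P (extend T a)
  extend-P {T} {a} p with extension? T a
  ... | yes (_ , q , _) = q
  ... | no _ = p

  ⊆-extend : ∀ {T a} → T ⊆ extend T a
  ⊆-extend {T} {a} with extension? T a
  ... | yes (_ , _ , T⊆S , _) = T⊆S
  ... | no _ = λ _ h → h

  extend-∋ : ∀ {T a S} → Extends T a S → extend T a a ≡ true
  extend-∋ {T} {a} e with extension? T a
  ... | yes (_ , _ , _ , Sa) = Sa
  ... | no ¬e = ⊥-elim (¬e (_ , e))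

  greedy : List A → (A → Bool) → (A → Bool)
  greedy [] T = T
  greedy (a ∷ as) T = greedy as (extend T a)

  greedy-P : ∀ as {T} → P T → P (greedy as T)
  greedy-P [] p = p
  greedy-P (a ∷ as) p = greedy-P as (extend-P p)

  ⊆-greedy : ∀ as {T} → T ⊆ greedy as T
  ⊆-greedy [] _ h = h
  ⊆-greedy (a ∷ as) b h = ⊆-greedy as b (⊆-extend b h)

  -- When a was processed, S itself was a candidate extension containing a.
  greedy-maximal : ∀ {as T S a} → a ∈ as → P S → greedy as T ⊆ S → S a ≡ true → greedy as T a ≡ true
  greedy-maximal {a ∷ as} (here refl) pS G⊆S Sa =
    ⊆-greedy as a (extend-∋ (pS , (λ b h → G⊆S b (⊆-greedy as b (⊆-extend b h))) , Sa))
  greedy-maximal (there a∈as) = greedy-maximal a∈as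

  maximal-extension : ∀ {Q} → P Q →
    Σ (A → Bool) λ T → P T × Q ⊆ T × (∀ S → P S → T ⊆ S → S ⊆ T)
  maximal-extension {Q} pQ =
    greedy elements Q , greedy-P elements pQ , ⊆-greedy elements ,
    λ S pS T⊆S a → greedy-maximal (∈-elements a) pS T⊆S

module _ {n : ℕ} where

  preLe-intro : ∀ (j k : Fin (suc n)) ω₁ ω₂ {a b} →
    (ωval j ω₁ a ≡ true → ωval k ω₂ b ≡ true) → preLe j k ω₁ ω₂ a b ≡ true
  preLe-intro j k ω₁ ω₂ {a} {b} h with ωval j ω₁ a | ωval k ω₂ b
  ... | true | true = refl
  ... | true | false = h refl
  ... | false | _ = refl

  preLe-elim : ∀ (j k : Fin (suc n)) ω₁ ω₂ {a b} →
    preLe j k ω₁ ω₂ a b ≡ true → ωval j ω₁ a ≡ true → ωval k ω₂ b ≡ true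
  preLe-elim j k ω₁ ω₂ {a} {b} h with ωval j ω₁ a | ωval k ω₂ b
  ... | true | true = λ _ → refl
  ... | true | false = λ _ → h
  ... | false | _ = λ ()

  preLe-refl : ∀ k ω {a} → preLe k k ω ω a a ≡ true
  preLe-refl k ω = preLe-intro k k ω ω id

  preLe-trans : ∀ j k l ω₁ ω₂ ω₃ {a b c} →
    preLe j k ω₁ ω₂ a b ≡ true → preLe k l ω₂ ω₃ b c ≡ true → preLe j l ω₁ ω₃ a c ≡ true
  preLe-trans j k l ω₁ ω₂ ω₃ h h' =
    preLe-intro j l ω₁ ω₃ (preLe-elim k l ω₂ ω₃ h' ∘ preLe-elim j k ω₁ ω₂ h)

  preLe-antisym : ∀ j k ω₁ ω₂ {a b} →
    preLe j k ω₁ ω₂ a b ≡ true → preLe k j ω₂ ω₁ b a ≡ true → ωval j ω₁ a ≡ ωval k ω₂ b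
  preLe-antisym j k ω₁ ω₂ h h' = ⇔→≡ (mk⇔ (preLe-elim j k ω₁ ω₂ h) (preLe-elim k j ω₂ ω₁ h'))

all-Const? : ∀ {n} {P : Const n → Set} → (∀ c → Dec (P c)) → Dec (∀ c → P c)
all-Const? P? = map′ (λ (p⊤ , p⊥ , pf , pt) → λ { ⊤c → p⊤ ; ⊥c → p⊥ ; (fc i) → pf i ; (tc i) → pt i })
                     (λ h → h ⊤c , h ⊥c , h ∘ fc , h ∘ tc)
                     (P? ⊤c ×-dec P? ⊥c ×-dec Fin.all? (P? ∘ fc) ×-dec Fin.all? (P? ∘ tc))

module _ {n : ℕ} (j k : Fin (suc n)) where
  private
    module Fⱼ = Finite (MCar-finite j)
    module Fₖ = Finite (MCar-finite k)

  Closed₂ : Rel₂ j k → (MCar j → MCar j → MCar j) → (MCar k → MCar k → MCar k) → Set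
  Closed₂ R f g = ∀ a b a' b' → R a b ≡ true → R a' b' ≡ true → R (f a a') (g b b') ≡ true

  Sub? : ∀ R S → Dec (Sub j k R S)
  Sub? R S = Fⱼ.all? λ a → Fₖ.all? λ b → R a b Bool.≟ true →-dec S a b Bool.≟ true

  IsSubuniverse? : ∀ R → Dec (IsSubuniverse j k R)
  IsSubuniverse? R =
    closed₂? (_⊗_ (𝐌 j)) (_⊗_ (𝐌 k)) ×-dec closed₂? (_⊕_ (𝐌 j)) (_⊕_ (𝐌 k)) ×-dec
    closed₂? (_∧_ (𝐌 j)) (_∧_ (𝐌 k)) ×-dec closed₂? (_∨_ (𝐌 j)) (_∨_ (𝐌 k)) ×-dec
    Sub? R (λ a b → R (¬_ (𝐌 j) a) (¬_ (𝐌 k) b)) ×-dec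
    all-Const? (λ c → R (const (𝐌 j) c) (const (𝐌 k) c) Bool.≟ true)
    where
    closed₂? : ∀ f g → Dec (Closed₂ R f g)
    closed₂? f g = Fⱼ.all? λ a → Fₖ.all? λ b → Fⱼ.all? λ a' → Fₖ.all? λ b' →
      R a b Bool.≟ true →-dec R a' b' Bool.≟ true →-dec R (f a a') (g b b') Bool.≟ true

  module _ {R S : Rel₂ j k} (R≗S : ∀ a b → R a b ≡ S a b) where
    private
      to : ∀ {a b} → R a b ≡ true → S a b ≡ true
      to = trans (sym (R≗S _ _))
      from : ∀ {a b} → S a b ≡ true → R a b ≡ true
      from = trans (R≗S _ _)

    Sub-resp : ∀ {L} → Sub j k R L → Sub j k S L
    Sub-resp R⊆L a b = R⊆L a b ∘ from

    IsSubuniverse-resp : IsSubuniverse j k R → IsSubuniverse j k S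
    IsSubuniverse-resp (c⊗ , c⊕ , c∧ , c∨ , c¬ , cc) =
      resp₂ c⊗ , resp₂ c⊕ , resp₂ c∧ , resp₂ c∨ , (λ a b h → to (c¬ a b (from h))) , to ∘ cc
      where
      resp₂ : ∀ {f g} → Closed₂ R f g → Closed₂ S f g
      resp₂ c a b a' b' h h' = to (c a b a' b' (from h) (from h'))

module _ {n : ℕ} (j k : Fin (suc n)) (ω₁ ω₂ : Ω) where

  extend-to-𝓡 : ∀ {Q} → IsSubuniverse j k Q → Sub j k Q (preLe j k ω₁ ω₂) →
    Σ (Rel₂ j k) λ T → In𝓡 j k ω₁ ω₂ T × Sub j k Q T
  extend-to-𝓡 Qsub Q≤ with maximal-extension (Qsub , Q≤)
    where
    open MaximalExtension (×-finite (MCar-finite j) (MCar-finite k))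
      {P = λ S → IsSubuniverse j k (curry S) × Sub j k (curry S) (preLe j k ω₁ ω₂)}
      (λ S → IsSubuniverse? j k (curry S) ×-dec Sub? j k (curry S) _)
      (λ e (sub , below) → IsSubuniverse-resp j k (curry e) sub , Sub-resp j k (curry e) below)
  ... | T , (Tsub , T≤) , Q⊆T , T-max =
    curry T ,
    (Tsub , T≤ , λ S Ssub S≤ T⊆S a b → T-max (uncurry S) (Ssub , S≤) (λ (a , b) → T⊆S a b) (a , b)) ,
    curry Q⊆T

module _ {n : ℕ} (k : Fin (suc n)) where
  open Finite (MCar-finite k) using (_≟_)

  Δ : Rel₂ k k
  Δ a b = does (a ≟ b)

  Δ-refl : ∀ a → Δ a a ≡ true
  Δ-refl a = dec-true (a ≟ a) refl

  Δ-sound : ∀ {a b} → Δ a b ≡ true → a ≡ b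
  Δ-sound {a} {b} = witness (a ≟ b)

  Δ-subuniverse : IsSubuniverse k k Δ
  Δ-subuniverse = closed₂ _ , closed₂ _ , closed₂ _ , closed₂ _ , closed¬ , λ _ → Δ-refl _
    where
    closed₂ : ∀ f → Closed₂ k k Δ f f
    closed₂ f a b a' b' h h' rewrite Δ-sound h | Δ-sound h' = Δ-refl _
    closed¬ : Sub k k Δ (λ a b → Δ (¬_ (𝐌 k) a) (¬_ (𝐌 k) b))
    closed¬ a b h rewrite Δ-sound h = Δ-refl _

  Δ-below : ∀ ω → Sub k k Δ (preLe k k ω ω)
  Δ-below ω a b h rewrite Δ-sound h = preLe-refl k ω

module Composition {n : ℕ} (j k l : Fin (suc n)) (R : Rel₂ j k) (S : Rel₂ k l) where
  open Finite (MCar-finite k) using (any?)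

  linked? : ∀ a c → Dec (∃ λ b → R a b ≡ true × S b c ≡ true)
  linked? a c = any? λ b → R a b Bool.≟ true ×-dec S b c Bool.≟ true

  R⨾S : Rel₂ j l
  R⨾S a c = does (linked? a c)

  ⨾-intro : ∀ {a b c} → R a b ≡ true → S b c ≡ true → R⨾S a c ≡ true
  ⨾-intro {a} {b} {c} r s = dec-true (linked? a c) (b , r , s)

  ⨾-elim : ∀ {a c} → R⨾S a c ≡ true → ∃ λ b → R a b ≡ true × S b c ≡ true
  ⨾-elim {a} {c} = witness (linked? a c)

  ⨾-subuniverse : IsSubuniverse j k R → IsSubuniverse k l S → IsSubuniverse j l R⨾S
  ⨾-subuniverse (r⊗ , r⊕ , r∧ , r∨ , r¬ , rc) (s⊗ , s⊕ , s∧ , s∨ , s¬ , sc) =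
    closed₂ r⊗ s⊗ , closed₂ r⊕ s⊕ , closed₂ r∧ s∧ , closed₂ r∨ s∨ , closed¬ ,
    λ c → ⨾-intro (rc c) (sc c)
    where
    closed₂ : ∀ {f g h} → Closed₂ j k R f g → Closed₂ k l S g h → Closed₂ j l R⨾S f h
    closed₂ rc sc a c a' c' h h' with ⨾-elim h | ⨾-elim h'
    ... | b , r , s | b' , r' , s' = ⨾-intro (rc _ _ _ _ r r') (sc _ _ _ _ s s')
    closed¬ : Sub j l R⨾S (λ a c → R⨾S (¬_ (𝐌 j) a) (¬_ (𝐌 l) c))
    closed¬ a c h with ⨾-elim h
    ... | b , r , s = ⨾-intro (r¬ _ _ r) (s¬ _ _ s)

  ⨾-below : ∀ {ω₁ ω₂ ω₃} → Sub j k R (preLe j k ω₁ ω₂) → Sub k l S (preLe k l ω₂ ω₃) →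
    Sub j l R⨾S (preLe j l ω₁ ω₃)
  ⨾-below R≤ S≤ a c h with ⨾-elim h
  ... | b , r , s = preLe-trans j k l _ _ _ (R≤ a b r) (S≤ b c s)

hom-eval : ∀ {n} {A B : Algebra n} {h : Carrier A → Carrier B} → IsHom A B h →
  ∀ ρ t → h (eval A ρ t) ≡ eval B (h ∘ ρ) t
hom-eval hh ρ (var x) = refl
hom-eval hh ρ (con c) = IsHom.pres-c hh c
hom-eval {B = B} hh ρ (s ⊗' t) =
  trans (IsHom.pres-⊗ hh _ _) (cong₂ (_⊗_ B) (hom-eval hh ρ s) (hom-eval hh ρ t))
hom-eval {B = B} hh ρ (s ⊕' t) =
  trans (IsHom.pres-⊕ hh _ _) (cong₂ (_⊕_ B) (hom-eval hh ρ s) (hom-eval hh ρ t))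
hom-eval {B = B} hh ρ (s ∧' t) =
  trans (IsHom.pres-∧ hh _ _) (cong₂ (_∧_ B) (hom-eval hh ρ s) (hom-eval hh ρ t))
hom-eval {B = B} hh ρ (s ∨' t) =
  trans (IsHom.pres-∨ hh _ _) (cong₂ (_∨_ B) (hom-eval hh ρ s) (hom-eval hh ρ t))
hom-eval {B = B} hh ρ (¬' t) = trans (IsHom.pres-¬ hh _) (cong (¬_ B) (hom-eval hh ρ t))

<ᵇ-threshold-injective : ∀ {n} {j k : Fin n} →
  (∀ (i : Fin n) → (toℕ i <ᵇ toℕ j) ≡ (toℕ i <ᵇ toℕ k)) → j ≡ k
<ᵇ-threshold-injective {j = j} {k} h with <-cmp (toℕ j) (toℕ k)
... | tri< j<k _ _ = ⊥-elim (<-irrefl refl (<ᵇ⇒< (toℕ j) (toℕ j) (subst T (sym (h j)) (<⇒<ᵇ j<k))))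
... | tri≈ _ j≡k _ = Fin.toℕ-injective j≡k
... | tri> _ _ k<j = ⊥-elim (<-irrefl refl (<ᵇ⇒< (toℕ k) (toℕ k) (subst T (h k) (<⇒<ᵇ k<j))))

module _ {n : ℕ} where

  γ-if : ∀ (k : Fin n) b → ωval (suc k) γ (if b then 1⁺ else t⁺) ≡ b
  γ-if k true = refl
  γ-if k false = refl

  δ-if : ∀ (k : Fin n) b → ωval (suc k) δ (if b then 0⁺ else f⁺) ≡ not b
  δ-if k true = refl
  δ-if k false = refl

  -- ⊤ and ⊥ tell 𝐌₀ from 𝐌ₖ (k ≥ 1) and γ from δ; for k ≥ 1 the index k is the
  -- threshold below which tᵢ ↦ 1⁺ (seen by γ) and fᵢ ↦ 0⁺ (seen by δ).
  constants-determine-carrier : ∀ (j k : Fin (suc n)) ω₁ ω₂ →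
    (∀ c → ωval j ω₁ (const (𝐌 j) c) ≡ ωval k ω₂ (const (𝐌 k) c)) → j ≡ k × ω₁ ≡ ω₂
  constants-determine-carrier zero zero γ γ h = refl , refl
  constants-determine-carrier zero zero δ δ h = refl , refl
  constants-determine-carrier (suc j) (suc k) γ γ h =
    <ᵇ-threshold-injective (λ i → trans (sym (γ-if j _)) (trans (h (tc i)) (γ-if k _))) , refl
  constants-determine-carrier (suc j) (suc k) δ δ h =
    <ᵇ-threshold-injective
      (λ i → not-injective (trans (sym (δ-if j _)) (trans (h (fc i)) (δ-if k _)))) , refl
  constants-determine-carrier zero zero γ δ h with () ← h ⊤c
  constants-determine-carrier zero zero δ γ h with () ← h ⊥c
  constants-determine-carrier zero (suc k) γ γ h with () ← h ⊤c
  constants-determine-carrier zero (suc k) γ δ h with () ← h ⊥c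
  constants-determine-carrier zero (suc k) δ γ h with () ← h ⊥c
  constants-determine-carrier zero (suc k) δ δ h with () ← h ⊤c
  constants-determine-carrier (suc j) zero γ γ h with () ← h ⊤c
  constants-determine-carrier (suc j) zero γ δ h with () ← h ⊥c
  constants-determine-carrier (suc j) zero δ γ h with () ← h ⊥c
  constants-determine-carrier (suc j) zero δ δ h with () ← h ⊤c
  constants-determine-carrier (suc j) (suc k) γ δ h with () ← h ⊤c
  constants-determine-carrier (suc j) (suc k) δ γ h with () ← h ⊤c

module _ {n : ℕ} where

  separators : List (Term n)
  separators = x ∷ ¬' x ∷ (x ⊕' f₀) ∷ (x ⊕' t₀) ∷ ((¬' x) ⊕' f₀) ∷ ((¬' x) ⊕' t₀) ∷ []
    where
    x = var 0
    f₀ = con (fc zero)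
    t₀ = con (tc zero)

  signature : ∀ (k : Fin (suc n)) → Ω → MCar k → List Bool
  signature k ω u = map (λ t → ωval k ω (eval (𝐌 k) (λ _ → u) t)) separators

  signature-injective? : ∀ k ω → Dec (∀ u v → signature k ω u ≡ signature k ω v → u ≡ v)
  signature-injective? k ω =
    all? λ u → all? λ v → ≡-dec Bool._≟_ (signature k ω u) (signature k ω v) →-dec u ≟ v
    where open Finite (MCar-finite k)

  signature-injective : ∀ k ω {u v} → signature k ω u ≡ signature k ω v → u ≡ v
  signature-injective k ω {u} {v} = toWitness (decided k ω) u v
    where
    -- Checked by evaluation; for 𝐌ₖ with k ≥ 1 it does not depend on k, since the
    -- separators mention only the constants f₀ ↦ 0⁺ and t₀ ↦ 1⁺.
    decided : ∀ k ω → True (signature-injective? k ω)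
    decided zero γ = _
    decided zero δ = _
    decided (suc _) γ = _
    decided (suc _) δ = _

module _ {n : ℕ} {A : Algebra n} where

  ≈Y-isEquivalence : IsEquivalence (_≈Y_ {A = A})
  ≈Y-isEquivalence = record
    { refl = refl , refl , λ _ → refl
    ; sym = λ { {⟨ _ , _ , _ ⟩} {⟨ _ , _ , _ ⟩} (refl , refl , e) → refl , refl , sym ∘ e }
    ; trans = λ { {⟨ _ , _ , _ ⟩} {⟨ _ , _ , _ ⟩} {⟨ _ , _ , _ ⟩} (refl , refl , e) (refl , refl , e') →
                  refl , refl , λ a → trans (e a) (e' a) }
    }

  open Y using (idx; car)

  point : (p : Y A) → Carrier A → MCar (idx p)
  point p = proj₁ (Y.hom p)

  ≤P-from-subuniverse : ∀ p q {Q : Rel₂ (idx p) (idx q)} → IsSubuniverse (idx p) (idx q) Q →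
    Sub (idx p) (idx q) Q (preLe (idx p) (idx q) (car p) (car q)) →
    (∀ a → Q (point p a) (point q a) ≡ true) → p ≤P q
  ≤P-from-subuniverse p q Qsub Q≤ pQq with extend-to-𝓡 (idx p) (idx q) (car p) (car q) Qsub Q≤
  ... | T , T∈𝓡 , Q⊆T = T , T∈𝓡 , λ a → Q⊆T _ _ (pQq a)

  ≤P-reflexive : ∀ {p q : Y A} → p ≈Y q → p ≤P q
  ≤P-reflexive {p@(⟨ k , _ , ω ⟩)} {q@(⟨ _ , _ , _ ⟩)} (refl , refl , p≗q) =
    ≤P-from-subuniverse p q (Δ-subuniverse k) (Δ-below k ω)
      (λ a → subst (λ v → Δ k (point p a) v ≡ true) (p≗q a) (Δ-refl k (point p a)))

  ≤P-trans : ∀ {p q r : Y A} → p ≤P q → q ≤P r → p ≤P r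
  ≤P-trans {p} {q} {r} (R , (Rsub , R≤ , _) , pRq) (S , (Ssub , S≤ , _) , qSr) =
    ≤P-from-subuniverse p r (⨾-subuniverse Rsub Ssub) (⨾-below R≤ S≤) (λ a → ⨾-intro (pRq a) (qSr a))
    where open Composition (idx p) (idx q) (idx r) R S

  Agree : Y A → Y A → Set
  Agree p q = ∀ a → ωval (idx p) (car p) (point p a) ≡ ωval (idx q) (car q) (point q a)

  ≤P-both-ways⇒Agree : ∀ {p q : Y A} → p ≤P q → q ≤P p → Agree p q
  ≤P-both-ways⇒Agree {p} {q} (R , (_ , R≤ , _) , pRq) (S , (_ , S≤ , _) , qSp) a =
    preLe-antisym (idx p) (idx q) (car p) (car q) (R≤ _ _ (pRq a)) (S≤ _ _ (qSp a))

  Agree-on-terms : ∀ p q → Agree p q → ∀ ρ t →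
    ωval (idx p) (car p) (eval (𝐌 (idx p)) (point p ∘ ρ) t) ≡
    ωval (idx q) (car q) (eval (𝐌 (idx q)) (point q ∘ ρ) t)
  Agree-on-terms p q h ρ t =
    subst₂ (λ u v → ωval (idx p) (car p) u ≡ ωval (idx q) (car q) v)
           (hom-eval (proj₂ (Y.hom p)) ρ t) (hom-eval (proj₂ (Y.hom q)) ρ t) (h (eval A ρ t))

  Agree⇒≈Y : ∀ {p q : Y A} → Agree p q → p ≈Y q
  Agree⇒≈Y {p@(⟨ j , _ , ω₁ ⟩)} {q@(⟨ k , _ , ω₂ ⟩)} h
    with constants-determine-carrier j k ω₁ ω₂ (Agree-on-terms p q h (λ _ → const A ⊤c) ∘ con)
  ... | refl , refl = refl , refl , λ a →
    signature-injective j ω₁ (map-cong (Agree-on-terms p q h (λ _ → a)) separators)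

  ≤P-antisym : ∀ {p q : Y A} → p ≤P q → q ≤P p → p ≈Y q
  ≤P-antisym {p} {q} p≤q q≤p = Agree⇒≈Y {p} {q} (≤P-both-ways⇒Agree {p} {q} p≤q q≤p)

  ≤P-isPartialOrder : IsPartialOrder (_≈Y_ {A = A}) _≤P_
  ≤P-isPartialOrder = record
    { isPreorder = record
      { isEquivalence = ≈Y-isEquivalence
      ; reflexive = λ {p q} → ≤P-reflexive {p} {q}
      ; trans = λ {p q r} → ≤P-trans {p} {q} {r}
      }
    ; antisym = λ {p q} → ≤P-antisym {p} {q}
    }

lemma7p6 : (n : ℕ) → n ≥ 1 → (A : Algebra n) → A ∈𝒱 →
    IsPartialOrder (_≈Y_ {A = A}) (_≤P_ {A = A})
lemma7p6 n _ A _ = ≤P-isPartialOrder
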